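{- Let $(L_n)_{n\ge0}$ be the Lucas sequence and $m\ge 0$. Call an integer $S$ a non-consecutive sum of $A_m=\{L_0,\ldots,L_m\}$ if $S=\sum_{i\in I}L_i$ for some (possibly empty) set $I\subseteq\{0,1,\ldots,m\}$ containing no two consecutive integers. Then: (1) if $m$ is odd, the set of non-consecutive sums of $A_m$ is exactly $\{0,1,\ldots,L_{m+1}-1\}$; (2) if $m$ is even, the set of non-consecutive sums of $A_m$ is exactly $\{0,1,\ldots,L_{m+1}+1\}\setminus\{L_{m+1}\}$.
   Context: The Lucas sequence is defined by $L_0=2$, $L_1=1$, and $L_n=L_{n-1}+L_{n-2}$ for $n\ge 2$. The empty sum equals $0$. -}

module Defs where

open import Data.Nat using (ℕ; zero; suc; _+_)
open import Data.Fin as Fin using (Fin; toℕ)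
open import Data.Vec using ([]; _∷_)
open import Data.Fin.Subset using (Subset; _∈_)
open import Data.Product using (Σ; _×_)
open import Relation.Nullary using (¬_)
open import Data.Bool using (if_then_else_)
open import Relation.Binary.PropositionalEquality using (_≡_)

L : ℕ → ℕ
L zero = 2
L (suc zero) = 1
L (suc (suc n)) = L (suc n) + L n

sumOver : ∀ {n} → Subset n → (Fin n → ℕ) → ℕ
sumOver [] f = 0
sumOver (b ∷ I) f = (if b then f Fin.zero else 0) + sumOver I (λ i → f (Fin.suc i))

NoConsecutive : ∀ {n} → Subset n → Set
NoConsecutive {n} I = ∀ (i j : Fin n) → suc (toℕ i) ≡ toℕ j → ¬ (i ∈ I × j ∈ I)

NonConsecutiveSum : ℕ → ℕ → Set
NonConsecutiveSum m S =
  Σ (Subset (suc m)) λ I → NoConsecutive I × (S ≡ sumOver I (λ i → L (toℕ i)))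

{-# OPTIONS --safe #-}
module Submission where

-- The sums of A_{m+2} are those of A_{m+1} together with L_{m+2} plus those of A_m,
-- according as L_{m+2} is left out or used (then L_{m+1} must be left out).  If the
-- sums of A_{m+1} and A_m are the predicted sets, the union is again of the predicted
-- shape with the parity flipped, by L_{m+3} = L_{m+2} + L_{m+1}.  Since a subset is a
-- vector read from index 0 upwards, the bulk of the work is to show that non-consecutive
-- sums may equally be generated from the top index downwards.

open import Defs
open import Data.Nat using (ℕ; zero; suc; _+_; _*_; _<_; _≤_; _<?_; z≤n; s≤s; _%_; _/_)
open import Data.Nat.Properties
open import Data.Nat.DivMod using (m≡m%n+[m/n]*n)
open import Algebra.Properties.CommutativeSemigroup +-commutativeSemigroup using (x∙yz≈y∙xz)
open import Data.Bool using (Bool; true; false; if_then_else_)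
open import Data.Fin using (Fin; toℕ)
open import Data.Fin.Subset using (Subset)
open import Data.Vec.Base using ([]; _∷_; _∷ʳ_; here; there)
open import Data.Product using (Σ; ∃-syntax; _×_; _,_; proj₁; proj₂)
open import Data.Sum using (_⊎_; inj₁; inj₂)
open import Data.Empty using (⊥-elim)
open import Function using (_∘_)
open import Function.Bundles using (_⇔_; mk⇔; Equivalence)
open import Function.Properties.Equivalence using () renaming (trans to ⇔-trans)
open import Relation.Nullary using (¬_; yes; no)
open import Relation.Binary.PropositionalEquality
  using (_≡_; _≢_; refl; sym; trans; cong; subst)

open Equivalence using (to; from)

private
  variable
    n S : ℕ
    b : Bool
    I : Subset n
    f : ℕ → ℕ

NonConsecutiveSumOf : (ℕ → ℕ) → ℕ → ℕ → Set
NonConsecutiveSumOf f n S =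
  Σ (Subset n) λ I → NoConsecutive I × S ≡ sumOver I (λ i → f (toℕ i))

noConsecutive-[_] : ∀ b → NoConsecutive (b ∷ [])
noConsecutive-[ b ] Fin.zero Fin.zero ()

noConsecutive-tail : NoConsecutive (b ∷ I) → NoConsecutive I
noConsecutive-tail nc i j i+1≡j (i∈I , j∈I) =
  nc (Fin.suc i) (Fin.suc j) (cong suc i+1≡j) (there i∈I , there j∈I)

noConsecutive-false∷ : NoConsecutive I → NoConsecutive (false ∷ I)
noConsecutive-false∷ nc Fin.zero    j           _ (() , _)
noConsecutive-false∷ nc (Fin.suc i) Fin.zero    ()
noConsecutive-false∷ nc (Fin.suc i) (Fin.suc j) e (there i∈I , there j∈I) =
  nc i j (suc-injective e) (i∈I , j∈I)

noConsecutive-true∷ : NoConsecutive (false ∷ I) → NoConsecutive (true ∷ false ∷ I)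
noConsecutive-true∷ nc Fin.zero    Fin.zero               ()
noConsecutive-true∷ nc Fin.zero    (Fin.suc Fin.zero)     _ (_ , there ())
noConsecutive-true∷ nc Fin.zero    (Fin.suc (Fin.suc j))  ()
noConsecutive-true∷ nc (Fin.suc i) Fin.zero               ()
noConsecutive-true∷ nc (Fin.suc i) (Fin.suc j)            e (there i∈ , there j∈) =
  nc i j (suc-injective e) (i∈ , j∈)

¬noConsecutive-true∷true∷ : ¬ NoConsecutive (true ∷ true ∷ I)
¬noConsecutive-true∷true∷ nc = nc Fin.zero (Fin.suc Fin.zero) refl (here , there here)

noConsecutive-∷ʳ-false : ∀ (I : Subset n) → NoConsecutive I → NoConsecutive (I ∷ʳ false)
noConsecutive-∷ʳ-false []                 _  = noConsecutive-[ false ]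
noConsecutive-∷ʳ-false (false ∷ I)        nc =
  noConsecutive-false∷ (noConsecutive-∷ʳ-false I (noConsecutive-tail nc))
noConsecutive-∷ʳ-false (true ∷ [])        _  = noConsecutive-true∷ noConsecutive-[ false ]
noConsecutive-∷ʳ-false (true ∷ false ∷ I) nc =
  noConsecutive-true∷ (noConsecutive-∷ʳ-false (false ∷ I) (noConsecutive-tail nc))
noConsecutive-∷ʳ-false (true ∷ true ∷ I)  nc = ⊥-elim (¬noConsecutive-true∷true∷ nc)

noConsecutive-∷ʳ-false-true : ∀ (I : Subset n) → NoConsecutive I →
                              NoConsecutive (I ∷ʳ false ∷ʳ true)
noConsecutive-∷ʳ-false-true []                 _  = noConsecutive-false∷ noConsecutive-[ true ]
noConsecutive-∷ʳ-false-true (false ∷ I)        nc =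
  noConsecutive-false∷ (noConsecutive-∷ʳ-false-true I (noConsecutive-tail nc))
noConsecutive-∷ʳ-false-true (true ∷ [])        _  =
  noConsecutive-true∷ (noConsecutive-false∷ noConsecutive-[ true ])
noConsecutive-∷ʳ-false-true (true ∷ false ∷ I) nc =
  noConsecutive-true∷ (noConsecutive-∷ʳ-false-true (false ∷ I) (noConsecutive-tail nc))
noConsecutive-∷ʳ-false-true (true ∷ true ∷ I)  nc = ⊥-elim (¬noConsecutive-true∷true∷ nc)

sumOver-∷ʳ : ∀ (I : Subset n) b (f : ℕ → ℕ) →
             sumOver (I ∷ʳ b) (λ i → f (toℕ i)) ≡
             (if b then f n else 0) + sumOver I (λ i → f (toℕ i))
sumOver-∷ʳ         []      b f = refl
sumOver-∷ʳ {suc n} (c ∷ I) b f =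
  trans (cong ((if c then f 0 else 0) +_) (sumOver-∷ʳ I b (f ∘ suc)))
        (x∙yz≈y∙xz (if c then f 0 else 0) (if b then f (suc n) else 0)
                   (sumOver I (λ i → f (suc (toℕ i)))))

-- Non-consecutive sums of f 0, …, f (n-1), generated by deciding about the largest
-- index first.  The summand 0 in [only0] is there to match sumOver (true ∷ []).
data SparseSum (f : ℕ → ℕ) : ℕ → ℕ → Set where
  empty : SparseSum f 0 0
  only0 : SparseSum f 1 (f 0 + 0)
  skip  : SparseSum f n S → SparseSum f (suc n) S
  take  : SparseSum f n S → SparseSum f (suc (suc n)) (f (suc n) + S)

skipˡ : SparseSum (f ∘ suc) n S → SparseSum f (suc n) S
skipˡ empty    = skip empty
skipˡ only0    = take empty
skipˡ (skip d) = skip (skipˡ d)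
skipˡ (take d) = take (skipˡ d)

takeˡ : SparseSum (f ∘ suc ∘ suc) n S → SparseSum f (suc (suc n)) (f 0 + S)
takeˡ     empty    = skip only0
takeˡ {f} only0    = subst (SparseSum f 3) (x∙yz≈y∙xz (f 2) (f 0) 0) (take only0)
takeˡ     (skip d) = skip (takeˡ d)
takeˡ {f} (take {n} {S} d) =
  subst (SparseSum f _) (x∙yz≈y∙xz (f (3 + n)) (f 0) S) (take (takeˡ d))

sumOver→sparseSum : ∀ f (I : Subset n) → NoConsecutive I →
                    SparseSum f n (sumOver I (λ i → f (toℕ i)))
sumOver→sparseSum f []                 _  = empty
sumOver→sparseSum f (false ∷ I)        nc = skipˡ (sumOver→sparseSum (f ∘ suc) I (noConsecutive-tail nc))
sumOver→sparseSum f (true ∷ [])        _  = only0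
sumOver→sparseSum f (true ∷ false ∷ I) nc =
  takeˡ (sumOver→sparseSum (f ∘ suc ∘ suc) I (noConsecutive-tail (noConsecutive-tail nc)))
sumOver→sparseSum f (true ∷ true ∷ I)  nc = ⊥-elim (¬noConsecutive-true∷true∷ nc)

sparseSum→nonConsecutiveSum : SparseSum f n S → NonConsecutiveSumOf f n S
sparseSum→nonConsecutiveSum empty = [] , (λ ()) , refl
sparseSum→nonConsecutiveSum only0 = true ∷ [] , noConsecutive-[ true ] , refl
sparseSum→nonConsecutiveSum {f} (skip d) with sparseSum→nonConsecutiveSum d
... | I , nc , refl = I ∷ʳ false , noConsecutive-∷ʳ-false I nc , sym (sumOver-∷ʳ I false f)
sparseSum→nonConsecutiveSum {f} (take {n} d) with sparseSum→nonConsecutiveSum d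
... | I , nc , refl = I ∷ʳ false ∷ʳ true , noConsecutive-∷ʳ-false-true I nc ,
  sym (trans (sumOver-∷ʳ (I ∷ʳ false) true f) (cong (f (suc n) +_) (sumOver-∷ʳ I false f)))

nonConsecutiveSum⇔sparseSum : NonConsecutiveSumOf f n S ⇔ SparseSum f n S
nonConsecutiveSum⇔sparseSum {f} = mk⇔ (λ { (I , nc , refl) → sumOver→sparseSum f I nc })
                                      sparseSum→nonConsecutiveSum

sparseSum-recurrence : ∀ {P Q : ℕ → Set} →
                       (∀ S → SparseSum f (suc n) S ⇔ P S) → (∀ S → SparseSum f n S ⇔ Q S) →
                       ∀ S → SparseSum f (suc (suc n)) S ⇔ (P S ⊎ ∃[ S′ ] Q S′ × S ≡ f (suc n) + S′)
sparseSum-recurrence {f} {n} {P} {Q} P⇔ Q⇔ _ = mk⇔ split merge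
  where
  split : ∀ {S} → SparseSum f (suc (suc n)) S → P S ⊎ ∃[ S′ ] Q S′ × S ≡ f (suc n) + S′
  split (skip d) = inj₁ (to (P⇔ _) d)
  split (take d) = inj₂ (_ , to (Q⇔ _) d , refl)
  merge : ∀ {S} → P S ⊎ (∃[ S′ ] Q S′ × S ≡ f (suc n) + S′) → SparseSum f (suc (suc n)) S
  merge (inj₁ p)              = skip (from (P⇔ _) p)
  merge (inj₂ (_ , q , refl)) = take (from (Q⇔ _) q)

below-or-above : ∀ b S → S < b ⊎ ∃[ S′ ] S ≡ b + S′
below-or-above b S with S <? b
... | yes S<b = inj₁ S<b
... | no  S≮b with S′ , b+S′≡S ← m≤n⇒∃[o]m+o≡n (≮⇒≥ S≮b) = inj₂ (S′ , sym b+S′≡S)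

interval-union : ∀ {a b S} → 2 ≤ a →
                 ((S ≤ b + 1 × S ≢ b) ⊎ ∃[ S′ ] S′ < a × S ≡ b + S′) ⇔ S < b + a
interval-union {a} {b} {S} 2≤a = mk⇔ bounded decompose
  where
  bounded : (S ≤ b + 1 × S ≢ b) ⊎ (∃[ S′ ] S′ < a × S ≡ b + S′) → S < b + a
  bounded (inj₁ (S≤b+1 , _))       = ≤-<-trans S≤b+1 (+-monoʳ-< b 2≤a)
  bounded (inj₂ (_ , S′<a , refl)) = +-monoʳ-< b S′<a
  decompose : S < b + a → (S ≤ b + 1 × S ≢ b) ⊎ ∃[ S′ ] S′ < a × S ≡ b + S′
  decompose S<b+a with below-or-above b S
  ... | inj₁ S<b         = inj₁ (≤-trans (<⇒≤ S<b) (m≤m+n b 1) , <⇒≢ S<b)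
  ... | inj₂ (S′ , refl) = inj₂ (S′ , +-cancelˡ-< b S′ a S<b+a , refl)

punctured-union : ∀ {a b S} →
                  (S < b ⊎ ∃[ S′ ] (S′ ≤ a + 1 × S′ ≢ a) × S ≡ b + S′) ⇔ (S ≤ b + a + 1 × S ≢ b + a)
punctured-union {a} {b} {S} = mk⇔ bounded decompose
  where
  bounded : S < b ⊎ (∃[ S′ ] (S′ ≤ a + 1 × S′ ≢ a) × S ≡ b + S′) → S ≤ b + a + 1 × S ≢ b + a
  bounded (inj₁ S<b) = ≤-trans (<⇒≤ S<b+a) (m≤m+n (b + a) 1) , <⇒≢ S<b+a
    where S<b+a = <-≤-trans S<b (m≤m+n b a)
  bounded (inj₂ (S′ , (S′≤a+1 , S′≢a) , refl)) =
    subst (b + S′ ≤_) (sym (+-assoc b a 1)) (+-monoʳ-≤ b S′≤a+1) , S′≢a ∘ +-cancelˡ-≡ b S′ a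
  decompose : S ≤ b + a + 1 × S ≢ b + a → S < b ⊎ ∃[ S′ ] (S′ ≤ a + 1 × S′ ≢ a) × S ≡ b + S′
  decompose (S≤b+a+1 , S≢b+a) with below-or-above b S
  ... | inj₁ S<b         = inj₁ S<b
  ... | inj₂ (S′ , refl) =
    inj₂ (S′ , (+-cancelˡ-≤ b S′ (a + 1) (subst (b + S′ ≤_) (+-assoc b a 1) S≤b+a+1) ,
                S≢b+a ∘ cong (b +_)) , refl)

Interval PuncturedInterval : ℕ → Set
Interval m = ∀ S → SparseSum L (suc m) S ⇔ S < L (suc m)
PuncturedInterval m = ∀ S → SparseSum L (suc m) S ⇔ (S ≤ L (suc m) + 1 × S ≢ L (suc m))

interval-step : ∀ {m} → 2 ≤ L (suc m) →
                PuncturedInterval (suc m) → Interval m → Interval (suc (suc m))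
interval-step 2≤L p i S = ⇔-trans (sparseSum-recurrence p i S) (interval-union 2≤L)

punctured-step : ∀ {m} → Interval (suc m) → PuncturedInterval m → PuncturedInterval (suc (suc m))
punctured-step i p S = ⇔-trans (sparseSum-recurrence i p S) punctured-union

punctured-0 : PuncturedInterval 0
punctured-0 S = mk⇔ bounds (sparse S)
  where
  bounds : SparseSum L 1 S → S ≤ 2 × S ≢ 1
  bounds (skip empty) = z≤n , λ ()
  bounds only0        = ≤-refl , λ ()
  sparse : ∀ S → S ≤ 2 × S ≢ 1 → SparseSum L 1 S
  sparse 0 _          = skip empty
  sparse 1 (_ , S≢1)  = ⊥-elim (S≢1 refl)
  sparse 2 _          = only0
  sparse (suc (suc (suc _))) (s≤s (s≤s ()) , _)

interval-1 : Interval 1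
interval-1 S = mk⇔ bounds (sparse S)
  where
  bounds : SparseSum L 2 S → S < 3
  bounds (skip (skip empty)) = s≤s z≤n
  bounds (skip only0)        = ≤-refl
  bounds (take empty)        = s≤s (s≤s z≤n)
  sparse : ∀ S → S < 3 → SparseSum L 2 S
  sparse 0 _ = skip (skip empty)
  sparse 1 _ = take empty
  sparse 2 _ = skip only0
  sparse (suc (suc (suc _))) (s≤s (s≤s (s≤s ())))

0<L : ∀ n → 0 < L n
0<L 0             = s≤s z≤n
0<L 1             = s≤s z≤n
0<L (suc (suc n)) = <-≤-trans (0<L (suc n)) (m≤m+n (L (suc n)) (L n))

lucasSums : ∀ k → PuncturedInterval (k * 2) × Interval (1 + k * 2)
lucasSums zero    = punctured-0 , interval-1
lucasSums (suc k) = next-punctured , interval-step 2≤L next-punctured (proj₂ (lucasSums k))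
  where
  next-punctured : PuncturedInterval (suc k * 2)
  next-punctured = punctured-step (proj₂ (lucasSums k)) (proj₁ (lucasSums k))
  2≤L : 2 ≤ L (suc k * 2)
  2≤L = +-mono-≤ (0<L (suc (k * 2))) (0<L (k * 2))

lemma3p1 : (m : ℕ)
    → ((m % 2 ≡ 1) → ∀ (S : ℕ) → NonConsecutiveSum m S ⇔ (S < L (suc m)))
    × ((m % 2 ≡ 0) → ∀ (S : ℕ) → NonConsecutiveSum m S ⇔ ((S ≤ L (suc m) + 1) × (S ≢ L (suc m))))
lemma3p1 m =
    (λ m%2≡1 S → ⇔-trans nonConsecutiveSum⇔sparseSum
                   (subst Interval (sym (halve m%2≡1)) (proj₂ (lucasSums (m / 2))) S))
  , (λ m%2≡0 S → ⇔-trans nonConsecutiveSum⇔sparseSum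
                   (subst PuncturedInterval (sym (halve m%2≡0)) (proj₁ (lucasSums (m / 2))) S))
  where
  halve : ∀ {r} → m % 2 ≡ r → m ≡ r + m / 2 * 2
  halve refl = m≡m%n+[m/n]*n m 2
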